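{- Let $S\subset\mathbb{Z}_+$ be a proper cofinite set, and let $n,\beta,m$ be positive integers with $\lfloor n/m\rfloor>2\beta$. Consider $\mathbf{L}_i$ as a random variable on $\Lambda_n^\beta$ with respect to the uniform probability measure on $\Lambda_n^\beta$ (equivalently $P_n(\cdot\mid\Lambda_n^\beta)$, where $P_n$ is uniform on all $S$-restricted compositions of $n$). Let $\vec W$ be a value of the decomposition vector with $\Lambda_{\vec W}\ne\emptyset$. If $1\le i\le m$, then for every real $t>0$, $$E_n\left(\mathbf{L}_i^t\mid\Lambda_n^\beta,\vec W\right)=E_{\pi_i}\left((\log\mathbf{B})^t\mid\Lambda_{\pi_i}^\beta\right),$$ where the left side is the expectation of $\mathbf{L}_i^t$ under the uniform measure on $\Lambda_{\vec W}$ and the right side is the expectation of $(\log\mathbf{B})^t$ under the uniform measure on $\Lambda_{\pi_i}^\beta$ ($\pi_i$ being the value determined by $\vec W$).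
   Context: "Proper cofinite" means $\mathbb{Z}_+\setminus S$ is finite and nonempty. An $S$-restricted composition of $n$ is a finite sequence of elements of $S$ summing to $n$; $\mathbf{B}$ of a sequence is the product of its entries. $\Lambda_k^\beta$ is the set of $S$-restricted compositions of $k$ all of whose parts are at most $\beta$. Decomposition: for $\vec\lambda=(\lambda_1,\dots,\lambda_\tau)\in\Lambda_n^\beta$ and $i=1,\dots,m$ let $\tau_i=\min\{t:\lambda_1+\dots+\lambda_t\ge i\lfloor n/m\rfloor\}$, $\tau_0=0$; $\Pi_0=(\lambda_{\tau_1},\dots,\lambda_{\tau_m})$, $\Pi_i=(\lambda_{\tau_{i-1}+1},\dots,\lambda_{\tau_i-1})$ for $1\le i\le m$, $\Pi_{m+1}=(\lambda_{\tau_m+1},\dots,\lambda_\tau)$ (possibly empty; $\mathbf{B}$ of the empty sequence is $1$). For $1\le i\le m+1$, $\pi_i$ is the sum of the entries of $\Pi_i$, $p_i=1+\lambda_1+\dots+\lambda_{\tau_{i-1}}$, $W_i=(\pi_i,p_i)$, $\vec W(\vec\lambda)=(W_1,\dots,W_{m+1})$, and $\Lambda_{\vec W}=\{\vec\lambda\in\Lambda_n^\beta:\vec W(\vec\lambda)=\vec W\}$. $\mathbf{L}_i(\vec\lambda)=\log\mathbf{B}(\Pi_i(\vec\lambda))$. -}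

module Defs where

open import Level using (Level; 0ℓ)
open import Data.Bool using (Bool; true; false; if_then_else_; _∧_)
open import Data.Nat using (ℕ; zero; suc; _+_; _*_; _∸_; _≤_; _≤?_; _/_; NonZero)
open import Data.Nat.Properties as ℕₚ using ()
open import Data.Product using (_×_; _,_; proj₁; proj₂)
import Data.Product.Properties as Prodₚ
open import Data.List using (List; []; _∷_; [_]; map; concatMap; take; drop; upTo; filter; length)
import Data.List.Properties as Listₚ
open import Data.Nat.ListAction using (sum; product)
open import Relation.Nullary using (Dec; ¬_; does)
open import Relation.Unary using (Pred; Decidable)
open import Relation.Binary.PropositionalEquality using (_≡_)
open import Algebra.Bundles using (CommutativeSemiring)

-- Restricted compositions.
-- S is given as a decidable predicate on ℕ (only its values on positive
-- integers are ever consulted).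

-- compsF S? β fuel n : all sequences of positive integers k with S k and
-- k ≤ β summing to n (fuel ≥ n guarantees completeness; every part ≥ 1).
compsF : {S : Pred ℕ 0ℓ} → Decidable S → ℕ → ℕ → ℕ → List (List ℕ)
compsF S? β _          zero    = [ [] ]
compsF S? β zero       (suc n) = []
compsF S? β (suc fuel) (suc n) =
  concatMap
    (λ k → if does (S? k) ∧ does (k ≤? β)
             then map (k ∷_) (compsF S? β fuel (suc n ∸ k))
             else [])
    (map suc (upTo (suc n)))

Λ : {S : Pred ℕ 0ℓ} → Decidable S → (β k : ℕ) → List (List ℕ)
Λ S? β k = compsF S? β k k

B : List ℕ → ℕ
B = product

-- τ c l = min { t : λ₁ + … + λ_t ≥ c }  (τ 0 l = 0).
τ : ℕ → List ℕ → ℕ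
τ zero    l        = zero
τ (suc c) []       = zero   -- never used when sum l ≥ c
τ (suc c) (x ∷ xs) = suc (τ (suc c ∸ x) xs)

τᵢ : (n m : ℕ) .{{_ : NonZero m}} → List ℕ → ℕ → ℕ
τᵢ n m l i = τ (i * (n / m)) l

-- Π_i(λ) for 1 ≤ i ≤ m : (λ_{τ_{i-1}+1}, …, λ_{τ_i - 1}).
Πᵢ : (n m : ℕ) .{{_ : NonZero m}} → List ℕ → ℕ → List ℕ
Πᵢ n m l i = drop (τᵢ n m l (i ∸ 1)) (take (τᵢ n m l i ∸ 1) l)

Πlast : (n m : ℕ) .{{_ : NonZero m}} → List ℕ → List ℕ
Πlast n m l = drop (τᵢ n m l m) l

Π : (n m : ℕ) .{{_ : NonZero m}} → List ℕ → ℕ → List ℕ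
Π n m l i = if does (i ≤? m) then Πᵢ n m l i else Πlast n m l

-- L_i(λ) = log B(Π_i(λ)); we keep the argument B(Π_i(λ)) of the log.
BΠ : (n m : ℕ) .{{_ : NonZero m}} → List ℕ → ℕ → ℕ
BΠ n m l i = B (Π n m l i)

Wᵢ : (n m : ℕ) .{{_ : NonZero m}} → List ℕ → ℕ → ℕ × ℕ
Wᵢ n m l i = sum (Π n m l i) , suc (sum (take (τᵢ n m l (i ∸ 1)) l))

Wvec : (n m : ℕ) .{{_ : NonZero m}} → List ℕ → List (ℕ × ℕ)
Wvec n m l = map (Wᵢ n m l) (map suc (upTo (suc m)))

_≟W_ : (u v : List (ℕ × ℕ)) → Dec (u ≡ v)
_≟W_ = Listₚ.≡-dec (Prodₚ.≡-dec ℕₚ._≟_ ℕₚ._≟_)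

ΛW : {S : Pred ℕ 0ℓ} → Decidable S → (n β m : ℕ) .{{_ : NonZero m}} →
     List (ℕ × ℕ) → List (List ℕ)
ΛW S? n β m W = filter (λ l → Wvec n m l ≟W W) (Λ S? β n)

-- π_i as determined by W (the first component of its i-th entry, 1-indexed).
πOf : List (ℕ × ℕ) → ℕ → ℕ
πOf []            _       = zero
πOf ((a , _) ∷ _) (suc zero) = a
πOf (_ ∷ W)       (suc (suc i)) = πOf W (suc i)
πOf (_ ∷ W)       zero = zero

module _ {c ℓ : Level} (R : CommutativeSemiring c ℓ) where
  open CommutativeSemiring R using (Carrier; 0#) renaming (_+_ to _+R_)

  sumR : {A : Set} → (A → Carrier) → List A → Carrier
  sumR f []       = 0#
  sumR f (x ∷ xs) = f x +R sumR f xs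

  _·_ : ℕ → Carrier → Carrier
  zero  · x = 0#
  suc k · x = x +R (k · x)

-- Pair every λ ∈ Λ_W with every u ∈ Λ^β_{π_i}. Since parts are at most β < ⌊n/m⌋, the i-th
-- block of λ sits between a prefix A, whose sum already reaches (i−1)⌊n/m⌋, and a suffix r whose
-- first part crosses i⌊n/m⌋. Hence for every w with the same sum as Π_i(λ) the composition
-- A ++ w ++ r has prefix A, suffix r, i-th block w, and the same decomposition vector as λ.
-- So (λ , u) ↦ (A ++ u ++ r , Π_i(λ)) is an involution of Λ_W × Λ^β_{π_i} that moves Π_i from
-- the first coordinate to the second, and summing f ∘ B over the product in both ways gives
-- |Λ^β_{π_i}| · Σ_{Λ_W} f(B(Π_i)) = |Λ_W| · Σ_{Λ^β_{π_i}} f(B).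

module Submission where

open import Defs
open import Level using (Level; 0ℓ)
open import Function using (_∘_; id)
open import Function.Bundles using (mk⇔)
open import Data.Bool using (if_then_else_)
open import Data.Nat using (ℕ; zero; suc; _+_; _*_; _∸_; _≤_; _<_; _≤?_; z≤n; s≤s; _/_; NonZero)
open import Data.Nat.Properties
  using (*-comm; *-mono-≤; *-monoˡ-≤; +-assoc; +-comm; +-identityʳ; +-monoʳ-<; +-monoʳ-≤; +-∸-assoc;
         0≢1+n; <-cmp; <-≤-trans; <⇒≤; <⇒≱; m+[n∸m]≡n; m+n∸m≡n; m+n∸n≡m; m<n⇒0<n∸m; m∸n≤m;
         m≤m+n; m≤n+m; m≤n+m∸n; m≤n+o⇒m∸n≤o; m≤n⇒m∸n≡0; m≤n⇒m≤1+n; m≤n⇒m⊓n≡m; suc-injective;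
         ∸-+-assoc; ∸-monoˡ-<; ∸-monoˡ-≤; ≤-<-trans; ≤-refl; ≤-reflexive; ≤-trans; ≰⇒>)
open import Data.Nat.DivMod using (m/n*n≤m)
open import Data.Nat.ListAction using (sum)
open import Data.Nat.ListAction.Properties using (sum-++)
open import Data.Product using (Σ; ∃₂; _×_; _,_; proj₁; proj₂)
open import Data.List
  using (List; []; _∷_; _++_; length; map; foldr; concatMap; take; drop; upTo; applyUpTo; cartesianProduct)
open import Data.List.Properties
  using (∷-injectiveˡ; ∷-injectiveʳ; ++-assoc; take++drop≡id; take-take; map-cong)
open import Data.List.Membership.Propositional using (_∈_; find; lose)
open import Data.List.Membership.Propositional.Properties
  using (∈-map⁺; ∈-map⁻; ∈-concatMap⁺; ∈-concatMap⁻; ∈-upTo⁺; ∈-upTo⁻;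
         ∈-cartesianProduct⁺; ∈-cartesianProduct⁻; ∈-filter⁺; ∈-filter⁻)
open import Data.List.Membership.Propositional.Properties.WithK using (unique∧set⇒bag)
open import Data.List.Relation.Binary.BagAndSetEquality using (∼bag⇒↭)
open import Data.List.Relation.Binary.Permutation.Propositional using (_↭_; ↭⇒↭ₛ′)
import Data.List.Relation.Binary.Permutation.Propositional.Properties as ↭
open import Data.List.Relation.Binary.Permutation.Setoid.Properties using (foldr-commMonoid)
open import Data.List.Relation.Unary.All using (All; []; _∷_)
import Data.List.Relation.Unary.All as All
import Data.List.Relation.Unary.All.Properties as All
open import Data.List.Relation.Unary.AllPairs using ([]; _∷_)
import Data.List.Relation.Unary.AllPairs as AllPairs
import Data.List.Relation.Unary.AllPairs.Properties as AllPairs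
open import Data.List.Relation.Unary.Any using (here; there)
open import Data.List.Relation.Unary.Unique.Propositional using (Unique)
import Data.List.Relation.Unary.Unique.Propositional.Properties as Unique
open import Relation.Nullary using (¬_; Dec; yes; no; does; _×-dec_; contradiction)
open import Relation.Nullary.Decidable using (dec-true; dec-false)
open import Relation.Unary using (Pred; Decidable)
open import Relation.Binary.Definitions using (tri<; tri≈; tri>)
open import Relation.Binary.PropositionalEquality as ≡ using (_≡_; _≢_; refl; cong; cong₂)
open import Algebra.Bundles using (CommutativeSemiring)

module _ {A : Set} where

  map⁺-Unique-injectiveOn : ∀ (φ : A → A) {xs} → Unique xs →
    (∀ {x y} → x ∈ xs → y ∈ xs → φ x ≡ φ y → x ≡ y) → Unique (map φ xs)
  map⁺-Unique-injectiveOn φ [] inj = []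
  map⁺-Unique-injectiveOn φ (x∉xs ∷ xs!) inj =
    All.map⁺ (All.tabulate λ y∈ φx≡φy → All.lookup x∉xs y∈ (inj (here refl) (there y∈) φx≡φy))
    ∷ map⁺-Unique-injectiveOn φ xs! λ x∈ y∈ → inj (there x∈) (there y∈)

  involution⇒map-↭ : ∀ (φ : A → A) {xs} → Unique xs →
    (∀ {x} → x ∈ xs → φ x ∈ xs) → (∀ {x} → x ∈ xs → φ (φ x) ≡ x) → map φ xs ↭ xs
  involution⇒map-↭ φ {xs} xs! closed involutive =
    ∼bag⇒↭ (unique∧set⇒bag φxs! xs! (mk⇔ to from))
    where
    φxs! : Unique (map φ xs)
    φxs! = map⁺-Unique-injectiveOn φ xs! λ x∈ y∈ φx≡φy →
      ≡.trans (≡.sym (involutive x∈)) (≡.trans (cong φ φx≡φy) (involutive y∈))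
    to : ∀ {z} → z ∈ map φ xs → z ∈ xs
    to z∈ with _ , x∈ , refl ← ∈-map⁻ φ z∈ = closed x∈
    from : ∀ {z} → z ∈ xs → z ∈ map φ xs
    from z∈ = ≡.subst (_∈ map φ xs) (involutive z∈) (∈-map⁺ φ (closed z∈))

  take-++-≤ : ∀ k (xs ys : List A) → k ≤ length xs → take k (xs ++ ys) ≡ take k xs
  take-++-≤ zero    xs       ys _         = refl
  take-++-≤ (suc k) (x ∷ xs) ys (s≤s k≤) = cong (x ∷_) (take-++-≤ k xs ys k≤)

  take-length-++ : ∀ (xs ys : List A) → take (length xs) (xs ++ ys) ≡ xs
  take-length-++ []       ys = refl
  take-length-++ (x ∷ xs) ys = cong (x ∷_) (take-length-++ xs ys)

  drop-length-++ : ∀ (xs ys : List A) → drop (length xs) (xs ++ ys) ≡ ys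
  drop-length-++ []       ys = refl
  drop-length-++ (x ∷ xs) ys = drop-length-++ xs ys

  take-length+-++ : ∀ (xs ys : List A) k → take (length xs + k) (xs ++ ys) ≡ xs ++ take k ys
  take-length+-++ []       ys k = refl
  take-length+-++ (x ∷ xs) ys k = cong (x ∷_) (take-length+-++ xs ys k)

  drop-length+-++ : ∀ (xs ys : List A) k → drop (length xs + k) (xs ++ ys) ≡ drop k ys
  drop-length+-++ []       ys k = refl
  drop-length+-++ (x ∷ xs) ys k = drop-length+-++ xs ys k

sum-++-middle : ∀ (xs : List ℕ) {ys ys′} zs → sum ys ≡ sum ys′ →
                sum (xs ++ ys ++ zs) ≡ sum (xs ++ ys′ ++ zs)
sum-++-middle xs {ys} {ys′} zs eq
  rewrite sum-++ xs (ys ++ zs) | sum-++ xs (ys′ ++ zs) | sum-++ ys zs | sum-++ ys′ zs | eq = refl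

module _ {A : Set} {p} {P : Set p} where

  ∈-if-does⁻ : (P? : Dec P) {x : A} {xs : List A} → x ∈ (if does P? then xs else []) → P × x ∈ xs
  ∈-if-does⁻ (yes p) x∈ = p , x∈

  ∈-if-does⁺ : (P? : Dec P) {x : A} {xs : List A} → P → x ∈ xs → x ∈ (if does P? then xs else [])
  ∈-if-does⁺ (yes _) _ x∈ = x∈
  ∈-if-does⁺ (no ¬p) p _  = contradiction p ¬p

  Unique-if-does : (P? : Dec P) {xs : List A} → Unique xs → Unique (if does P? then xs else [])
  Unique-if-does (yes _) xs! = xs!
  Unique-if-does (no _)  _   = AllPairs.[]

module _ {A B : Set} where

  concatMap⁺-Unique : (g : A → List B) {xs : List A} → Unique xs → (∀ x → Unique (g x)) →
    (∀ {x x′ y} → y ∈ g x → y ∈ g x′ → x ≡ x′) → Unique (concatMap g xs)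
  concatMap⁺-Unique g xs! g! tagged =
    Unique.concat⁺ (All.map⁺ (All.universal g! _))
      (AllPairs.map⁺ (AllPairs.map (λ x≢x′ {_} (y∈ , y∈′) → x≢x′ (tagged y∈ y∈′)) xs!))

module _ {c ℓ : Level} (R : CommutativeSemiring c ℓ) where
  open CommutativeSemiring R
    using (Carrier; _≈_; 0#; setoid; isEquivalence; +-commutativeMonoid; +-isCommutativeMonoid; reflexive)
    renaming (_+_ to _+ᴿ_; +-cong to +ᴿ-cong; +-congˡ to +ᴿ-congˡ; +-identityˡ to +ᴿ-identityˡ;
              +-assoc to +ᴿ-assoc; refl to ≈-refl; sym to ≈-sym; trans to ≈-trans)
  open import Algebra.Properties.CommutativeMonoid.Mult +-commutativeMonoid
    using (×-distrib-+) renaming (_×_ to _×ᴿ_)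
  open import Relation.Binary.Reasoning.Setoid setoid

  ·≗× : ∀ k x → _·_ R k x ≡ k ×ᴿ x
  ·≗× zero    x = refl
  ·≗× (suc k) x = cong (x +ᴿ_) (·≗× k x)

  ×-zeroʳ : ∀ k → k ×ᴿ 0# ≈ 0#
  ×-zeroʳ zero    = ≈-refl
  ×-zeroʳ (suc k) = ≈-trans (+ᴿ-identityˡ _) (×-zeroʳ k)

  module _ {A : Set} where

    sumR≡foldr : (g : A → Carrier) (xs : List A) → sumR R g xs ≡ foldr _+ᴿ_ 0# (map g xs)
    sumR≡foldr g []       = refl
    sumR≡foldr g (x ∷ xs) = cong (g x +ᴿ_) (sumR≡foldr g xs)

    sumR-↭ : (g : A → Carrier) {xs ys : List A} → xs ↭ ys → sumR R g xs ≈ sumR R g ys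
    sumR-↭ g {xs} {ys} xs↭ys = begin
      sumR R g xs             ≡⟨ sumR≡foldr g xs ⟩
      foldr _+ᴿ_ 0# (map g xs) ≈⟨ foldr-commMonoid setoid +-isCommutativeMonoid
                                   (↭⇒↭ₛ′ isEquivalence (↭.map⁺ g xs↭ys)) ⟩
      foldr _+ᴿ_ 0# (map g ys) ≡⟨ ≡.sym (sumR≡foldr g ys) ⟩
      sumR R g ys             ∎

    sumR-++ : (g : A → Carrier) (xs ys : List A) → sumR R g (xs ++ ys) ≈ sumR R g xs +ᴿ sumR R g ys
    sumR-++ g []       ys = ≈-sym (+ᴿ-identityˡ _)
    sumR-++ g (x ∷ xs) ys = ≈-trans (+ᴿ-congˡ (sumR-++ g xs ys)) (≈-sym (+ᴿ-assoc _ _ _))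

    sumR-map : {B : Set} (g : B → Carrier) (f : A → B) (xs : List A) →
               sumR R g (map f xs) ≡ sumR R (g ∘ f) xs
    sumR-map g f []       = refl
    sumR-map g f (x ∷ xs) = cong (g (f x) +ᴿ_) (sumR-map g f xs)

    sumR-const : (x : Carrier) (xs : List A) → sumR R (λ _ → x) xs ≡ length xs ×ᴿ x
    sumR-const x []       = refl
    sumR-const x (_ ∷ xs) = cong (x +ᴿ_) (sumR-const x xs)

    ×-sumR : (k : ℕ) (g : A → Carrier) (xs : List A) → k ×ᴿ sumR R g xs ≈ sumR R (λ x → k ×ᴿ g x) xs
    ×-sumR k g []       = ×-zeroʳ k
    ×-sumR k g (x ∷ xs) = ≈-trans (×-distrib-+ (g x) (sumR R g xs) k) (+ᴿ-congˡ (×-sumR k g xs))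

    sumR-involution : (g : A → Carrier) (φ : A → A) {xs : List A} → Unique xs →
      (∀ {x} → x ∈ xs → φ x ∈ xs) → (∀ {x} → x ∈ xs → φ (φ x) ≡ x) →
      sumR R (g ∘ φ) xs ≈ sumR R g xs
    sumR-involution g φ {xs} xs! closed involutive = begin
      sumR R (g ∘ φ) xs  ≡⟨ ≡.sym (sumR-map g φ xs) ⟩
      sumR R g (map φ xs) ≈⟨ sumR-↭ g (involution⇒map-↭ φ xs! closed involutive) ⟩
      sumR R g xs         ∎

  module _ {A B : Set} where

    sumR-cartesianProduct-proj₁ : (g : A → Carrier) (xs : List A) (ys : List B) →
      sumR R (g ∘ proj₁) (cartesianProduct xs ys) ≈ length ys ×ᴿ sumR R g xs
    sumR-cartesianProduct-proj₁ g xs ys = ≈-trans (go xs) (≈-sym (×-sumR (length ys) g xs))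
      where
      go : (xs : List A) → sumR R (g ∘ proj₁) (cartesianProduct xs ys) ≈ sumR R (λ x → length ys ×ᴿ g x) xs
      go []       = ≈-refl
      go (x ∷ xs) = begin
        sumR R (g ∘ proj₁) (map (x ,_) ys ++ cartesianProduct xs ys)
          ≈⟨ sumR-++ (g ∘ proj₁) (map (x ,_) ys) _ ⟩
        sumR R (g ∘ proj₁) (map (x ,_) ys) +ᴿ sumR R (g ∘ proj₁) (cartesianProduct xs ys)
          ≈⟨ +ᴿ-cong (reflexive (≡.trans (sumR-map (g ∘ proj₁) (x ,_) ys) (sumR-const (g x) ys))) (go xs) ⟩
        length ys ×ᴿ g x +ᴿ sumR R (λ x → length ys ×ᴿ g x) xs ∎

    sumR-cartesianProduct-proj₂ : (h : B → Carrier) (xs : List A) (ys : List B) →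
      sumR R (h ∘ proj₂) (cartesianProduct xs ys) ≈ length xs ×ᴿ sumR R h ys
    sumR-cartesianProduct-proj₂ h []       ys = ≈-refl
    sumR-cartesianProduct-proj₂ h (x ∷ xs) ys = begin
      sumR R (h ∘ proj₂) (map (x ,_) ys ++ cartesianProduct xs ys)
        ≈⟨ sumR-++ (h ∘ proj₂) (map (x ,_) ys) _ ⟩
      sumR R (h ∘ proj₂) (map (x ,_) ys) +ᴿ sumR R (h ∘ proj₂) (cartesianProduct xs ys)
        ≈⟨ +ᴿ-cong (reflexive (sumR-map (h ∘ proj₂) (x ,_) ys)) (sumR-cartesianProduct-proj₂ h xs ys) ⟩
      sumR R h ys +ᴿ length xs ×ᴿ sumR R h ys ∎

    -- (x , y) ↦ (ψ x y , κ x) is an involution of xs × ys: ψ x y puts y in place of κ x.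
    double-counting : (κ : A → B) (ψ : A → B → A) {xs : List A} {ys : List B} →
      Unique xs → Unique ys →
      (∀ {x} → x ∈ xs → κ x ∈ ys) →
      (∀ {x} → x ∈ xs → ∀ {y} → y ∈ ys → ψ x y ∈ xs) →
      (∀ {x} → x ∈ xs → ∀ {y} → y ∈ ys → κ (ψ x y) ≡ y) →
      (∀ {x} → x ∈ xs → ∀ {y} → y ∈ ys → ψ (ψ x y) (κ x) ≡ x) →
      (g : B → Carrier) →
      _·_ R (length ys) (sumR R (g ∘ κ) xs) ≈ _·_ R (length xs) (sumR R g ys)
    double-counting κ ψ {xs} {ys} xs! ys! κ∈ ψ∈ κψ ψψ g = begin
      _·_ R (length ys) (sumR R (g ∘ κ) xs)       ≡⟨ ·≗× (length ys) _ ⟩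
      length ys ×ᴿ sumR R (g ∘ κ) xs              ≈⟨ ≈-sym (sumR-cartesianProduct-proj₁ (g ∘ κ) xs ys) ⟩
      sumR R (g ∘ proj₂ ∘ exchange) pairs         ≈⟨ sumR-involution (g ∘ proj₂) exchange pairs! closed involutive ⟩
      sumR R (g ∘ proj₂) pairs                    ≈⟨ sumR-cartesianProduct-proj₂ g xs ys ⟩
      length xs ×ᴿ sumR R g ys                    ≡⟨ ≡.sym (·≗× (length xs) _) ⟩
      _·_ R (length xs) (sumR R g ys)             ∎
      where
      pairs : List (A × B)
      pairs = cartesianProduct xs ys
      exchange : A × B → A × B
      exchange (x , y) = ψ x y , κ x
      pairs! : Unique pairs
      pairs! = Unique.cartesianProduct⁺ xs! ys!
      closed : ∀ {p} → p ∈ pairs → exchange p ∈ pairs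
      closed p∈ with x∈ , y∈ ← ∈-cartesianProduct⁻ xs ys p∈ = ∈-cartesianProduct⁺ (ψ∈ x∈ y∈) (κ∈ x∈)
      involutive : ∀ {p} → p ∈ pairs → exchange (exchange p) ≡ p
      involutive p∈ with x∈ , y∈ ← ∈-cartesianProduct⁻ xs ys p∈ = ≡.cong₂ _,_ (ψψ x∈ y∈) (κψ x∈ y∈)

open ≡.≡-Reasoning

module Compositions {S : Pred ℕ 0ℓ} (S? : Decidable S) (β : ℕ) where

  Part : ℕ → Set
  Part k = 1 ≤ k × k ≤ β × S k

  private
    admissible? : (k : ℕ) → Dec (S k × k ≤ β)
    admissible? k = S? k ×-dec (k ≤? β)

    extensions : ℕ → ℕ → ℕ → List (List ℕ)
    extensions fuel n k = if does (admissible? k) then map (k ∷_) (compsF S? β fuel (suc n ∸ k)) else []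

  ∈-compsF-suc⁻ : ∀ {fuel n l} → l ∈ compsF S? β (suc fuel) (suc n) →
    ∃₂ λ k l′ → l ≡ k ∷ l′ × Part k × k ≤ suc n × l′ ∈ compsF S? β fuel (suc n ∸ k)
  ∈-compsF-suc⁻ {fuel} {n} l∈
    with k , k∈ , l∈ₖ ← find (∈-concatMap⁻ (extensions fuel n) {xs = map suc (upTo (suc n))} l∈)
    with j , j∈ , refl ← ∈-map⁻ suc k∈
    with (Sk , k≤β) , l∈′ ← ∈-if-does⁻ (admissible? (suc j)) l∈ₖ
    with l′ , l′∈ , refl ← ∈-map⁻ (suc j ∷_) l∈′
    = suc j , l′ , refl , (s≤s z≤n , k≤β , Sk) , ∈-upTo⁻ j∈ , l′∈

  ∈-compsF-suc⁺ : ∀ {fuel n k l} → Part k → k ≤ suc n → l ∈ compsF S? β fuel (suc n ∸ k) →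
    k ∷ l ∈ compsF S? β (suc fuel) (suc n)
  ∈-compsF-suc⁺ {fuel} {n} {suc j} (_ , k≤β , Sk) k≤ l∈ =
    ∈-concatMap⁺ (extensions fuel n) (lose (∈-map⁺ suc (∈-upTo⁺ k≤))
      (∈-if-does⁺ (admissible? (suc j)) (Sk , k≤β) (∈-map⁺ (suc j ∷_) l∈)))

  ∈-compsF⁻ : ∀ fuel k {l} → l ∈ compsF S? β fuel k → All Part l × sum l ≡ k
  ∈-compsF⁻ fuel       zero    (here refl) = [] , refl
  ∈-compsF⁻ (suc fuel) (suc n) l∈
    with k , l′ , refl , part , k≤ , l′∈ ← ∈-compsF-suc⁻ {fuel} {n} l∈
    with parts , sum≡ ← ∈-compsF⁻ fuel (suc n ∸ k) l′∈
    = part ∷ parts , ≡.trans (cong (k +_) sum≡) (m+[n∸m]≡n k≤)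

  ∈-compsF⁺ : ∀ fuel k {l} → All Part l → sum l ≡ k → k ≤ fuel → l ∈ compsF S? β fuel k
  ∈-compsF⁺ fuel       zero    {[]}        _                     _  _ = here refl
  ∈-compsF⁺ fuel       zero    {suc _ ∷ _} _                     () _
  ∈-compsF⁺ _          _       {zero ∷ _}  ((() , _) ∷ _)         _  _
  ∈-compsF⁺ zero       (suc n)             _                     _  ()
  ∈-compsF⁺ (suc fuel) (suc n) {[]}        _                     () _
  ∈-compsF⁺ (suc fuel) (suc n) {suc j ∷ l} (part ∷ parts) sum≡ (s≤s n≤fuel) =
    ∈-compsF-suc⁺ {fuel} {n} part (≡.subst (suc j ≤_) sum≡ (m≤m+n (suc j) (sum l)))
      (∈-compsF⁺ fuel (n ∸ j) parts
        (≡.trans (≡.sym (m+n∸m≡n (suc j) (sum l))) (cong (_∸ suc j) sum≡))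
        (≤-trans (m∸n≤m n j) n≤fuel))

  compsF-Unique : ∀ fuel k → Unique (compsF S? β fuel k)
  compsF-Unique fuel       zero    = [] AllPairs.∷ AllPairs.[]
  compsF-Unique zero       (suc n) = AllPairs.[]
  compsF-Unique (suc fuel) (suc n) =
    concatMap⁺-Unique (extensions fuel n) (Unique.map⁺ suc-injective (Unique.upTo⁺ (suc n)))
      (λ k → Unique-if-does (admissible? k) (Unique.map⁺ ∷-injectiveʳ (compsF-Unique fuel (suc n ∸ k))))
      tagged
    where
    tagged : ∀ {k k′ l} → l ∈ extensions fuel n k → l ∈ extensions fuel n k′ → k ≡ k′
    tagged {k} {k′} l∈ l∈′
      with _ , l∈ₖ ← ∈-if-does⁻ (admissible? k) l∈ | _ , l∈ₖ′ ← ∈-if-does⁻ (admissible? k′) l∈′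
      with _ , _ , refl ← ∈-map⁻ (k ∷_) l∈ₖ | _ , _ , eq ← ∈-map⁻ (k′ ∷_) l∈ₖ′
      = ∷-injectiveˡ eq

  ∈-Λ⁻ : ∀ k {l} → l ∈ Λ S? β k → All Part l × sum l ≡ k
  ∈-Λ⁻ k = ∈-compsF⁻ k k

  ∈-Λ⁺ : ∀ {k l} → All Part l → sum l ≡ k → l ∈ Λ S? β k
  ∈-Λ⁺ {k} parts sum-l = ∈-compsF⁺ k k parts sum-l ≤-refl

  Λ-Unique : ∀ k → Unique (Λ S? β k)
  Λ-Unique k = compsF-Unique k k

sum-take-mono : ∀ {a b} (l : List ℕ) → a ≤ b → sum (take a l) ≤ sum (take b l)
sum-take-mono {zero}          l        _         = z≤n
sum-take-mono {suc a} {suc b} []       _         = z≤n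
sum-take-mono {suc a} {suc b} (x ∷ l)  (s≤s a≤b) = +-monoʳ-≤ x (sum-take-mono l a≤b)

-- prefixSum ((j ∸ 1) * ⌊n/m⌋) is p_j − 1 and segment ((j ∸ 1) * ⌊n/m⌋) (j * ⌊n/m⌋) is Π_j.
prefixSum : ℕ → List ℕ → ℕ
prefixSum c l = sum (take (τ c l) l)

segment : ℕ → ℕ → List ℕ → List ℕ
segment c d l = drop (τ c l) (take (τ d l ∸ 1) l)

τ≤length : ∀ c l → τ c l ≤ length l
τ≤length zero    l       = z≤n
τ≤length (suc c) []      = z≤n
τ≤length (suc c) (x ∷ l) = s≤s (τ≤length (suc c ∸ x) l)

τ-[] : ∀ c → τ c [] ≡ 0
τ-[] zero    = refl
τ-[] (suc c) = refl

τ-positive : ∀ {c} l → 0 < c → l ≢ [] → 1 ≤ τ c l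
τ-positive {suc c} []      _ l≢[] = contradiction refl l≢[]
τ-positive {suc c} (x ∷ l) _ _    = s≤s z≤n

m+n<o⇒n<o∸m : ∀ m n {o} → m + n < o → n < o ∸ m
m+n<o⇒n<o∸m m n m+n<o = ≡.subst (_< _ ∸ m) (m+n∸m≡n m n) (∸-monoˡ-< m+n<o (m≤m+n m n))

τ-++ˡ : ∀ c (xs ys : List ℕ) → c ≤ sum xs → τ c (xs ++ ys) ≡ τ c xs
τ-++ˡ zero    xs       ys _  = refl
τ-++ˡ (suc c) (x ∷ xs) ys c≤ = cong suc (τ-++ˡ (suc c ∸ x) xs ys (m≤n+o⇒m∸n≤o (suc c) x c≤))

τ-++ʳ : ∀ c (xs ys : List ℕ) → sum xs < c → τ c (xs ++ ys) ≡ length xs + τ (c ∸ sum xs) ys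
τ-++ʳ c       []       ys _   = refl
τ-++ʳ (suc c) (x ∷ xs) ys s<c = cong suc (begin
  τ (suc c ∸ x) (xs ++ ys)                ≡⟨ τ-++ʳ (suc c ∸ x) xs ys (m+n<o⇒n<o∸m x (sum xs) s<c) ⟩
  length xs + τ (suc c ∸ x ∸ sum xs) ys   ≡⟨ cong (λ d → length xs + τ d ys) (∸-+-assoc (suc c) x (sum xs)) ⟩
  length xs + τ (suc c ∸ (x + sum xs)) ys ∎)

τ-take-τ : ∀ c l → τ c (take (τ c l) l) ≡ length (take (τ c l) l)
τ-take-τ zero    l       = refl
τ-take-τ (suc c) []      = refl
τ-take-τ (suc c) (x ∷ l) = cong suc (τ-take-τ (suc c ∸ x) l)

c≤prefixSum : ∀ c l → c ≤ sum l → c ≤ prefixSum c l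
c≤prefixSum zero    l       _  = z≤n
c≤prefixSum (suc c) (x ∷ l) c≤ =
  ≤-trans (m≤n+m∸n (suc c) x) (+-monoʳ-≤ x (c≤prefixSum (suc c ∸ x) l (m≤n+o⇒m∸n≤o (suc c) x c≤)))

prefixSum<+ : ∀ {β} c l → 1 ≤ β → All (_≤ β) l → prefixSum c l < c + β
prefixSum<+ {β} zero    l       1≤β _ = 1≤β
prefixSum<+ {β} (suc c) []      1≤β _ = ≤-trans 1≤β (m≤n+m β (suc c))
prefixSum<+ {β} (suc c) (x ∷ l) 1≤β (x≤β ∷ l≤β) with x ≤? suc c
... | yes x≤c = ≡.subst (x + prefixSum (suc c ∸ x) l <_)
                  (≡.trans (≡.sym (+-assoc x (suc c ∸ x) β)) (cong (_+ β) (m+[n∸m]≡n x≤c)))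
                  (+-monoʳ-< x (prefixSum<+ (suc c ∸ x) l 1≤β l≤β))
... | no  x≰c rewrite m≤n⇒m∸n≡0 (<⇒≤ (≰⇒> x≰c)) =
  ≤-trans (s≤s (≤-reflexive (+-identityʳ x))) (≤-trans (s≤s x≤β) (s≤s (m≤n+m β c)))

sum-take-τ∸1< : ∀ c l → 0 < c → sum (take (τ c l ∸ 1) l) < c
sum-take-τ∸1< (suc c) []       _ = s≤s z≤n
sum-take-τ∸1< (suc c) (x ∷ xs) _ with x ≤? c
... | no  x≰c rewrite m≤n⇒m∸n≡0 (≰⇒> x≰c) = s≤s z≤n
... | yes x≤c with τ (suc c ∸ x) xs | sum-take-τ∸1< (suc c ∸ x) xs (m<n⇒0<n∸m (s≤s x≤c))
...   | zero  | _  = s≤s z≤n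
...   | suc t | IH = ≡.subst (x + sum (take t xs) <_) (m+[n∸m]≡n (m≤n⇒m≤1+n x≤c)) (+-monoʳ-< x IH)

τ-drop-τ∸1 : ∀ c l → 0 < c → c ≤ sum l → τ (c ∸ sum (take (τ c l ∸ 1) l)) (drop (τ c l ∸ 1) l) ≡ 1
τ-drop-τ∸1 (suc c) (x ∷ xs) _ c≤ with x ≤? c
... | no  x≰c rewrite m≤n⇒m∸n≡0 (≰⇒> x≰c) = cong suc (cong (λ d → τ d xs) (m≤n⇒m∸n≡0 (≰⇒> x≰c)))
... | yes x≤c
    with τ (suc c ∸ x) xs | τ-positive xs 0<c∸x xs≢[]
       | τ-drop-τ∸1 (suc c ∸ x) xs 0<c∸x (m≤n+o⇒m∸n≤o (suc c) x c≤)
  where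
  0<c∸x : 0 < suc c ∸ x
  0<c∸x = m<n⇒0<n∸m (s≤s x≤c)
  xs≢[] : xs ≢ []
  xs≢[] refl = <⇒≱ (s≤s x≤c) (≤-trans c≤ (≤-reflexive (+-identityʳ x)))
...   | suc t | _ | IH = ≡.trans (cong (λ d → τ d (drop t xs)) (≡.sym (∸-+-assoc (suc c) x _))) IH

segment-++ˡ : ∀ {c d} (xs ys : List ℕ) → c ≤ sum xs → d ≤ sum xs → segment c d (xs ++ ys) ≡ segment c d xs
segment-++ˡ {c} {d} xs ys c≤ d≤ rewrite τ-++ˡ c xs ys c≤ | τ-++ˡ d xs ys d≤ =
  cong (drop (τ c xs)) (take-++-≤ (τ d xs ∸ 1) xs ys (≤-trans (m∸n≤m _ 1) (τ≤length d xs)))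

prefixSum-++ˡ : ∀ {c} (xs ys : List ℕ) → c ≤ sum xs → prefixSum c (xs ++ ys) ≡ prefixSum c xs
prefixSum-++ˡ {c} xs ys c≤ rewrite τ-++ˡ c xs ys c≤ = cong sum (take-++-≤ (τ c xs) xs ys (τ≤length c xs))

prefixSum-++ʳ : ∀ {c} (xs ys : List ℕ) → sum xs < c →
                prefixSum c (xs ++ ys) ≡ sum xs + prefixSum (c ∸ sum xs) ys
prefixSum-++ʳ {c} xs ys s<c rewrite τ-++ʳ c xs ys s<c | take-length+-++ xs ys (τ (c ∸ sum xs) ys) =
  sum-++ xs (take (τ (c ∸ sum xs) ys) ys)

drop-τ-++ʳ : ∀ {c} (xs ys : List ℕ) → sum xs < c →
             drop (τ c (xs ++ ys)) (xs ++ ys) ≡ drop (τ (c ∸ sum xs) ys) ys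
drop-τ-++ʳ {c} xs ys s<c rewrite τ-++ʳ c xs ys s<c = drop-length+-++ xs ys _

segment-++ʳ : ∀ {c d} (xs ys : List ℕ) → sum xs < c → sum xs < d → ys ≢ [] →
              segment c d (xs ++ ys) ≡ segment (c ∸ sum xs) (d ∸ sum xs) ys
segment-++ʳ {c} {d} xs ys s<c s<d ys≢[] rewrite τ-++ʳ c xs ys s<c | τ-++ʳ d xs ys s<d = begin
  drop (length xs + tc) (take (length xs + td ∸ 1) (xs ++ ys))
    ≡⟨ cong (λ k → drop (length xs + tc) (take k (xs ++ ys))) (+-∸-assoc (length xs) 1≤td) ⟩
  drop (length xs + tc) (take (length xs + (td ∸ 1)) (xs ++ ys))
    ≡⟨ cong (drop (length xs + tc)) (take-length+-++ xs ys (td ∸ 1)) ⟩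
  drop (length xs + tc) (xs ++ take (td ∸ 1) ys)
    ≡⟨ drop-length+-++ xs (take (td ∸ 1) ys) tc ⟩
  drop tc (take (td ∸ 1) ys) ∎
  where
  tc td : ℕ
  tc = τ (c ∸ sum xs) ys
  td = τ (d ∸ sum xs) ys
  1≤td : 1 ≤ td
  1≤td = τ-positive ys (m<n⇒0<n∸m s<d) ys≢[]

πOf-applyUpTo : (g : ℕ → ℕ × ℕ) (f : ℕ → ℕ) {k j : ℕ} → j < k →
                πOf (map g (map suc (applyUpTo f k))) (suc j) ≡ proj₁ (g (suc (f j)))
πOf-applyUpTo g f {suc k} {zero}  _         = refl
πOf-applyUpTo g f {suc k} {suc j} (s≤s j<k) = πOf-applyUpTo g (f ∘ suc) j<k

module Blocks (n m : ℕ) .{{_ : NonZero m}} where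

  q : ℕ
  q = n / m

  prefix : ℕ → List ℕ → List ℕ
  prefix i l = take (τᵢ n m l (i ∸ 1)) l

  suffix : ℕ → List ℕ → List ℕ
  suffix i l = drop (τᵢ n m l i ∸ 1) l

  replaceBlock : ℕ → List ℕ → List ℕ → List ℕ
  replaceBlock i l u = prefix i l ++ u ++ suffix i l

  Π-≤ : ∀ {j} l → j ≤ m → Π n m l j ≡ Πᵢ n m l j
  Π-≤ {j} l j≤m = cong (λ b → if b then Πᵢ n m l j else Πlast n m l) (dec-true (j ≤? m) j≤m)

  Π-≰ : ∀ {j} l → ¬ j ≤ m → Π n m l j ≡ Πlast n m l
  Π-≰ {j} l j≰m = cong (λ b → if b then Πᵢ n m l j else Πlast n m l) (dec-false (j ≤? m) j≰m)

  πOf-Wvec : ∀ {i} l → 1 ≤ i → i ≤ m → πOf (Wvec n m l) i ≡ sum (Π n m l i)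
  πOf-Wvec {suc j} l _ i≤m = πOf-applyUpTo (Wᵢ n m l) id (m≤n⇒m≤1+n i≤m)

  record Frame (i : ℕ) (A r : List ℕ) (s : ℕ) : Set where
    field
      prefix-reaches    : (i ∸ 1) * q ≤ sum A
      block-falls-short : sum A + s < i * q
      prefix-minimal    : τ ((i ∸ 1) * q) A ≡ length A
      suffix-crosses    : τ (i * q ∸ (sum A + s)) r ≡ 1

  module Filled {i A r s} (1≤i : 1 ≤ i) (i≤m : i ≤ m) (frame : Frame i A r s) where
    open Frame frame

    r≢[] : r ≢ []
    r≢[] refl = 0≢1+n (≡.trans (≡.sym (τ-[] _)) suffix-crosses)

    below : ∀ {j} → j ≤ i ∸ 1 → j * q ≤ sum A
    below j≤ = ≤-trans (*-monoˡ-≤ q j≤) prefix-reaches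

    above : ∀ {j} → i ≤ j → sum A + s < j * q
    above i≤j = <-≤-trans block-falls-short (*-monoˡ-≤ q i≤j)

    module _ {w : List ℕ} (sum-w : sum w ≡ s) where

      private
        L : List ℕ
        L = A ++ w ++ r

        L-assoc : L ≡ (A ++ w) ++ r
        L-assoc = ≡.sym (++-assoc A w r)

        sum-Aw : sum (A ++ w) ≡ sum A + s
        sum-Aw = ≡.trans (sum-++ A w) (cong (sum A +_) sum-w)

        shift : ∀ {c} → sum A + s < c → sum (A ++ w) < c
        shift {c} = ≡.subst (_< c) (≡.sym sum-Aw)

      τ-start : τ ((i ∸ 1) * q) L ≡ length A
      τ-start = ≡.trans (τ-++ˡ _ A (w ++ r) prefix-reaches) prefix-minimal

      τ-end : τ (i * q) L ∸ 1 ≡ length (A ++ w)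
      τ-end = begin
        τ (i * q) L ∸ 1
          ≡⟨ cong (λ l → τ (i * q) l ∸ 1) L-assoc ⟩
        τ (i * q) ((A ++ w) ++ r) ∸ 1
          ≡⟨ cong (_∸ 1) (τ-++ʳ _ (A ++ w) r (shift block-falls-short)) ⟩
        length (A ++ w) + τ (i * q ∸ sum (A ++ w)) r ∸ 1
          ≡⟨ cong (λ t → length (A ++ w) + τ (i * q ∸ t) r ∸ 1) sum-Aw ⟩
        length (A ++ w) + τ (i * q ∸ (sum A + s)) r ∸ 1
          ≡⟨ cong (λ t → length (A ++ w) + t ∸ 1) suffix-crosses ⟩
        length (A ++ w) + 1 ∸ 1
          ≡⟨ m+n∸n≡m _ 1 ⟩
        length (A ++ w) ∎

      prefix-fill : prefix i L ≡ A
      prefix-fill = ≡.trans (cong (λ k → take k L) τ-start) (take-length-++ A (w ++ r))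

      suffix-fill : suffix i L ≡ r
      suffix-fill = begin
        drop (τ (i * q) L ∸ 1) L           ≡⟨ cong₂ drop τ-end L-assoc ⟩
        drop (length (A ++ w)) ((A ++ w) ++ r) ≡⟨ drop-length-++ (A ++ w) r ⟩
        r                                   ∎

      Πᵢ-fill : Πᵢ n m L i ≡ w
      Πᵢ-fill = begin
        drop (τ ((i ∸ 1) * q) L) (take (τ (i * q) L ∸ 1) L)
          ≡⟨ cong₂ (λ a b → drop a (take b L)) τ-start τ-end ⟩
        drop (length A) (take (length (A ++ w)) L)
          ≡⟨ cong (drop (length A) ∘ take (length (A ++ w))) L-assoc ⟩
        drop (length A) (take (length (A ++ w)) ((A ++ w) ++ r))
          ≡⟨ cong (drop (length A)) (take-length-++ (A ++ w) r) ⟩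
        drop (length A) (A ++ w)
          ≡⟨ drop-length-++ A w ⟩
        w ∎

      prefixSum-above : ∀ {c} → sum A + s < c → prefixSum c L ≡ sum A + s + prefixSum (c ∸ (sum A + s)) r
      prefixSum-above {c} lt = begin
        prefixSum c L                                  ≡⟨ cong (prefixSum c) L-assoc ⟩
        prefixSum c ((A ++ w) ++ r)                    ≡⟨ prefixSum-++ʳ (A ++ w) r (shift lt) ⟩
        sum (A ++ w) + prefixSum (c ∸ sum (A ++ w)) r ≡⟨ cong (λ t → t + prefixSum (c ∸ t) r) sum-Aw ⟩
        sum A + s + prefixSum (c ∸ (sum A + s)) r     ∎

      segment-above : ∀ {c d} → sum A + s < c → sum A + s < d →
                      segment c d L ≡ segment (c ∸ (sum A + s)) (d ∸ (sum A + s)) r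
      segment-above {c} {d} lc ld = begin
        segment c d L                                   ≡⟨ cong (segment c d) L-assoc ⟩
        segment c d ((A ++ w) ++ r)                     ≡⟨ segment-++ʳ (A ++ w) r (shift lc) (shift ld) r≢[] ⟩
        segment (c ∸ sum (A ++ w)) (d ∸ sum (A ++ w)) r ≡⟨ cong (λ t → segment (c ∸ t) (d ∸ t) r) sum-Aw ⟩
        segment (c ∸ (sum A + s)) (d ∸ (sum A + s)) r   ∎

      drop-τ-above : ∀ {c} → sum A + s < c → drop (τ c L) L ≡ drop (τ (c ∸ (sum A + s)) r) r
      drop-τ-above {c} lt = begin
        drop (τ c L) L                           ≡⟨ cong (λ l → drop (τ c l) l) L-assoc ⟩
        drop (τ c ((A ++ w) ++ r)) ((A ++ w) ++ r) ≡⟨ drop-τ-++ʳ (A ++ w) r (shift lt) ⟩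
        drop (τ (c ∸ sum (A ++ w)) r) r          ≡⟨ cong (λ t → drop (τ (c ∸ t) r) r) sum-Aw ⟩
        drop (τ (c ∸ (sum A + s)) r) r           ∎

    -- Every threshold j q is at most sum A or exceeds sum A + s, so only the i-th block sees w.
    module _ {w w′ : List ℕ} (sum-w : sum w ≡ s) (sum-w′ : sum w′ ≡ s) where

      private
        L L′ : List ℕ
        L  = A ++ w ++ r
        L′ = A ++ w′ ++ r

      prefixSum-fill : ∀ j → prefixSum (j * q) L ≡ prefixSum (j * q) L′
      prefixSum-fill j with j ≤? i ∸ 1
      ... | yes j≤ =
        ≡.trans (prefixSum-++ˡ A (w ++ r) (below j≤)) (≡.sym (prefixSum-++ˡ A (w′ ++ r) (below j≤)))
      ... | no  j≰ =
        ≡.trans (prefixSum-above sum-w (above i≤j)) (≡.sym (prefixSum-above sum-w′ (above i≤j)))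
        where
        i≤j : i ≤ j
        i≤j = ≡.subst (_≤ j) (m+[n∸m]≡n 1≤i) (≰⇒> j≰)

      sum-Π-fill : ∀ j → sum (Π n m L j) ≡ sum (Π n m L′ j)
      sum-Π-fill j with j ≤? m
      ... | no j≰m = cong sum (begin
        Π n m L j                              ≡⟨ Π-≰ L j≰m ⟩
        drop (τ (m * q) L) L                   ≡⟨ drop-τ-above sum-w (above i≤m) ⟩
        drop (τ (m * q ∸ (sum A + s)) r) r     ≡⟨ ≡.sym (drop-τ-above sum-w′ (above i≤m)) ⟩
        drop (τ (m * q) L′) L′                 ≡⟨ ≡.sym (Π-≰ L′ j≰m) ⟩
        Π n m L′ j                             ∎)
      ... | yes j≤m rewrite Π-≤ L j≤m | Π-≤ L′ j≤m with <-cmp j i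
      ...   | tri< j<i _ _ =
        cong sum (≡.trans (segment-++ˡ A (w ++ r) lc ld) (≡.sym (segment-++ˡ A (w′ ++ r) lc ld)))
        where
        lc : (j ∸ 1) * q ≤ sum A
        lc = below (≤-trans (m∸n≤m j 1) (∸-monoˡ-≤ 1 j<i))
        ld : j * q ≤ sum A
        ld = below (∸-monoˡ-≤ 1 j<i)
      ...   | tri≈ _ refl _ = begin
        sum (Πᵢ n m L i)  ≡⟨ cong sum (Πᵢ-fill sum-w) ⟩
        sum w             ≡⟨ ≡.trans sum-w (≡.sym sum-w′) ⟩
        sum w′            ≡⟨ cong sum (Πᵢ-fill sum-w′) ⟨
        sum (Πᵢ n m L′ i) ∎
      ...   | tri> _ _ i<j =
        cong sum (≡.trans (segment-above sum-w lc ld) (≡.sym (segment-above sum-w′ lc ld)))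
        where
        lc : sum A + s < (j ∸ 1) * q
        lc = above (∸-monoˡ-≤ 1 i<j)
        ld : sum A + s < j * q
        ld = above (<⇒≤ i<j)

      Wᵢ-fill : ∀ j → Wᵢ n m L j ≡ Wᵢ n m L′ j
      Wᵢ-fill j = cong₂ _,_ (sum-Π-fill j) (cong suc (prefixSum-fill (j ∸ 1)))

      Wvec-fill : Wvec n m L ≡ Wvec n m L′
      Wvec-fill = map-cong Wᵢ-fill (map suc (upTo (suc m)))

  module Decomposition {β i l} (1≤β : 1 ≤ β) (β<q : β < q) (1≤i : 1 ≤ i) (i≤m : i ≤ m)
                       (l≤β : All (_≤ β) l) (sum-l : sum l ≡ n) where

    private
      c₀ c₁ a b : ℕ
      c₀ = (i ∸ 1) * q
      c₁ = i * q
      a  = τ c₀ l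
      b  = τ c₁ l

      c₁≡c₀+q : c₁ ≡ c₀ + q
      c₁≡c₀+q = ≡.trans (cong (_* q) (≡.sym (m+[n∸m]≡n 1≤i))) (+-comm q c₀)

      0<c₁ : 0 < c₁
      0<c₁ = *-mono-≤ 1≤i (≤-trans (s≤s z≤n) β<q)

      c₁≤sum-l : c₁ ≤ sum l
      c₁≤sum-l = ≡.subst (c₁ ≤_) (≡.sym sum-l)
        (≤-trans (*-monoˡ-≤ q i≤m) (≡.subst (_≤ n) (*-comm q m) (m/n*n≤m n m)))

      c₀≤sum-l : c₀ ≤ sum l
      c₀≤sum-l = ≤-trans (≡.subst (c₀ ≤_) (≡.sym c₁≡c₀+q) (m≤m+n c₀ q)) c₁≤sum-l

      prefixSum<c₁ : prefixSum c₀ l < c₁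
      prefixSum<c₁ = <-≤-trans (prefixSum<+ c₀ l 1≤β l≤β)
        (≤-trans (+-monoʳ-≤ c₀ (<⇒≤ β<q)) (≤-reflexive (≡.sym c₁≡c₀+q)))

      -- The only use of β < q: the prefix overshoots (i−1)q by less than β, so it stays below iq.
      a<b : a < b
      a<b = ≰⇒> λ b≤a → <⇒≱ prefixSum<c₁ (≤-trans (c≤prefixSum c₁ l c₁≤sum-l) (sum-take-mono l b≤a))

      prefix++block : prefix i l ++ Πᵢ n m l i ≡ take (b ∸ 1) l
      prefix++block = begin
        take a l ++ drop a (take (b ∸ 1) l)              ≡⟨ cong (_++ drop a (take (b ∸ 1) l)) take-a ⟨
        take a (take (b ∸ 1) l) ++ drop a (take (b ∸ 1) l) ≡⟨ take++drop≡id a (take (b ∸ 1) l) ⟩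
        take (b ∸ 1) l                                    ∎
        where
        take-a : take a (take (b ∸ 1) l) ≡ take a l
        take-a = ≡.trans (take-take a (b ∸ 1) l) (cong (λ k → take k l) (m≤n⇒m⊓n≡m (∸-monoˡ-≤ 1 a<b)))

      sum-prefix++block : sum (prefix i l) + sum (Πᵢ n m l i) ≡ sum (take (b ∸ 1) l)
      sum-prefix++block = ≡.trans (≡.sym (sum-++ (prefix i l) _)) (cong sum prefix++block)

    split : l ≡ prefix i l ++ Πᵢ n m l i ++ suffix i l
    split = begin
      l                                          ≡⟨ take++drop≡id (b ∸ 1) l ⟨
      take (b ∸ 1) l ++ suffix i l               ≡⟨ cong (_++ suffix i l) prefix++block ⟨
      (prefix i l ++ Πᵢ n m l i) ++ suffix i l   ≡⟨ ++-assoc (prefix i l) _ _ ⟩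
      prefix i l ++ Πᵢ n m l i ++ suffix i l     ∎

    frame : Frame i (prefix i l) (suffix i l) (sum (Πᵢ n m l i))
    frame = record
      { prefix-reaches    = c≤prefixSum c₀ l c₀≤sum-l
      ; block-falls-short = ≡.subst (_< c₁) (≡.sym sum-prefix++block) (sum-take-τ∸1< c₁ l 0<c₁)
      ; prefix-minimal    = τ-take-τ c₀ l
      ; suffix-crosses    = ≡.trans (cong (λ t → τ (c₁ ∸ t) (suffix i l)) sum-prefix++block)
                                    (τ-drop-τ∸1 c₁ l 0<c₁ c₁≤sum-l)
      }


module Exchange {S : Pred ℕ 0ℓ} (S? : Decidable S) (n β m : ℕ) .{{_ : NonZero m}}
                (1≤β : 1 ≤ β) (β<q : β < n / m) (W : List (ℕ × ℕ))
                {i : ℕ} (1≤i : 1 ≤ i) (i≤m : i ≤ m) where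

  open Blocks n m
  open Compositions S? β

  ∈-ΛW⁻ : ∀ {l} → l ∈ ΛW S? n β m W → All Part l × sum l ≡ n × Wvec n m l ≡ W
  ∈-ΛW⁻ l∈ with l∈Λ , Wl≡W ← ∈-filter⁻ (λ l → Wvec n m l ≟W W) l∈
               with parts , sum-l ← ∈-Λ⁻ n l∈Λ
               = parts , sum-l , Wl≡W

  ∈-ΛW⁺ : ∀ {l} → All Part l → sum l ≡ n → Wvec n m l ≡ W → l ∈ ΛW S? n β m W
  ∈-ΛW⁺ parts sum-l Wl≡W = ∈-filter⁺ (λ l → Wvec n m l ≟W W) (∈-Λ⁺ parts sum-l) Wl≡W

  ΛW-Unique : Unique (ΛW S? n β m W)
  ΛW-Unique = Unique.filter⁺ (λ l → Wvec n m l ≟W W) (Λ-Unique n)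

  module _ {l : List ℕ} (l∈ : l ∈ ΛW S? n β m W) where

    private
      parts : All Part l
      parts = proj₁ (∈-ΛW⁻ l∈)
      sum-l : sum l ≡ n
      sum-l = proj₁ (proj₂ (∈-ΛW⁻ l∈))
      Wl≡W : Wvec n m l ≡ W
      Wl≡W = proj₂ (proj₂ (∈-ΛW⁻ l∈))

    open Decomposition 1≤β β<q 1≤i i≤m (All.map (proj₁ ∘ proj₂) parts) sum-l
    open Filled 1≤i i≤m frame

    π≡sum-block : πOf W i ≡ sum (Πᵢ n m l i)
    π≡sum-block = begin
      πOf W i              ≡⟨ cong (λ V → πOf V i) Wl≡W ⟨
      πOf (Wvec n m l) i   ≡⟨ πOf-Wvec l 1≤i i≤m ⟩
      sum (Π n m l i)      ≡⟨ cong sum (Π-≤ l i≤m) ⟩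
      sum (Πᵢ n m l i)     ∎

    private
      parts-split : All Part (prefix i l) × All Part (Πᵢ n m l i) × All Part (suffix i l)
      parts-split with ps , pvr ← All.++⁻ (prefix i l) (≡.subst (All Part) split parts)
                  with pv , pr ← All.++⁻ (Πᵢ n m l i) pvr = ps , pv , pr

    block∈ : Π n m l i ∈ Λ S? β (πOf W i)
    block∈ = ≡.subst (_∈ Λ S? β (πOf W i)) (≡.sym (Π-≤ l i≤m))
               (∈-Λ⁺ (proj₁ (proj₂ parts-split)) (≡.sym π≡sum-block))

    module _ {u : List ℕ} (u∈ : u ∈ Λ S? β (πOf W i)) where

      private
        sum-u : sum u ≡ sum (Πᵢ n m l i)
        sum-u = ≡.trans (proj₂ (∈-Λ⁻ (πOf W i) u∈)) π≡sum-block

      replaceBlock∈ : replaceBlock i l u ∈ ΛW S? n β m W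
      replaceBlock∈ = ∈-ΛW⁺ (All.++⁺ ps (All.++⁺ (proj₁ (∈-Λ⁻ (πOf W i) u∈)) pr)) sum≡n W≡W
        where
        ps : All Part (prefix i l)
        ps = proj₁ parts-split
        pr : All Part (suffix i l)
        pr = proj₂ (proj₂ parts-split)
        sum≡n : sum (replaceBlock i l u) ≡ n
        sum≡n = begin
          sum (prefix i l ++ u ++ suffix i l)          ≡⟨ sum-++-middle (prefix i l) (suffix i l) sum-u ⟩
          sum (prefix i l ++ Πᵢ n m l i ++ suffix i l) ≡⟨ cong sum split ⟨
          sum l                                        ≡⟨ sum-l ⟩
          n                                            ∎
        W≡W : Wvec n m (replaceBlock i l u) ≡ W
        W≡W = ≡.trans (Wvec-fill sum-u refl) (≡.trans (cong (Wvec n m) (≡.sym split)) Wl≡W)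

      Π-replaceBlock : Π n m (replaceBlock i l u) i ≡ u
      Π-replaceBlock = ≡.trans (Π-≤ (replaceBlock i l u) i≤m) (Πᵢ-fill sum-u)

      replaceBlock-involutive : replaceBlock i (replaceBlock i l u) (Π n m l i) ≡ l
      replaceBlock-involutive = begin
        prefix i (replaceBlock i l u) ++ Π n m l i ++ suffix i (replaceBlock i l u)
          ≡⟨ cong₂ (λ A r → A ++ Π n m l i ++ r) (prefix-fill sum-u) (suffix-fill sum-u) ⟩
        prefix i l ++ Π n m l i ++ suffix i l
          ≡⟨ cong (λ v → prefix i l ++ v ++ suffix i l) (Π-≤ l i≤m) ⟩
        prefix i l ++ Πᵢ n m l i ++ suffix i l
          ≡⟨ split ⟨
        l ∎

lemma10 : {S : Pred ℕ 0ℓ} (S? : Decidable S) →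
            -- S is proper cofinite in ℤ₊
            Σ ℕ (λ N → (k : ℕ) → N ≤ k → S k) →
            Σ ℕ (λ k → 1 ≤ k × ¬ S k) →
            (n β m : ℕ) .{{_ : NonZero m}} → 1 ≤ n → 1 ≤ β →
            2 * β < n / m →
            (W : List (ℕ × ℕ)) → ¬ ΛW S? n β m W ≡ [] →
            (i : ℕ) → 1 ≤ i → i ≤ m →
            -- for every real-valued (in fact any commutative-semiring-valued)
            -- function f of B, with f b = (log b)^t for the paper's t > 0:
            {c ℓ : Level} (R : CommutativeSemiring c ℓ) →
            (f : ℕ → CommutativeSemiring.Carrier R) →
            CommutativeSemiring._≈_ R
              (_·_ R (length (Λ S? β (πOf W i)))
                     (sumR R (λ l → f (BΠ n m l i)) (ΛW S? n β m W)))
              (_·_ R (length (ΛW S? n β m W))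
                     (sumR R (λ l → f (B l)) (Λ S? β (πOf W i))))
lemma10 S? _ _ n β m _ 1≤β 2β<q W _ i 1≤i i≤m R f =
  double-counting R (λ l → Π n m l i) (replaceBlock i)
    ΛW-Unique (Λ-Unique (πOf W i)) block∈ replaceBlock∈ Π-replaceBlock replaceBlock-involutive (f ∘ B)
  where
  open Exchange S? n β m 1≤β (≤-<-trans (m≤m+n β (β + 0)) 2β<q) W 1≤i i≤m
  open Blocks n m using (replaceBlock)
  open Compositions S? β using (Λ-Unique)
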